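{- Let $L$ be a bounded lattice, $\to$ a preconditional on $L$, and $\neg$ an antitone unary operation on $L$ such that $a\to0\le\neg a$ for all $a\in L$. Let $P=\{(x,x\to y)\mid x,y\in L\}$, define $\vartriangleleft$ on $P$ by $(a,b)\vartriangleleft(c,d)$ iff $c\not\le b$, and define $\blacktriangleleft$ on $P$ by $(x',x'\to y')\blacktriangleleft(x,x\to y)$ iff $(x',x'\to y')\vartriangleleft(x,x\to y)$ and for all $a\in L$, $x\le\neg a$ implies $x'\not\le a$. Then there is a complete embedding of $(L,\to,\neg)$ into $(\mathfrak{L}(P,\vartriangleleft),\twoheadrightarrow_\vartriangleleft,\neg_\blacktriangleleft)$, which is an isomorphism if $L$ is complete.
   Context: A preconditional on a bounded lattice $L$ is a binary operation $\to$ such that for all $a,b,c$: (1) $1\to a\le a$; (2) $a\wedge b\le a\to b$; (3) $a\to b\le a\to(a\wedge b)$; (4) if $b\le a$ then $a\to(b\to c)\le b\to c$; (5) if $b\le c$ then $a\to b\le a\to c$. Antitone: $a\le b\Rightarrow\neg b\le\neg a$. For a nonempty set $X$ with binary relation $\vartriangleleft$ (write $y\vartriangleright x$ for $x\vartriangleleft y$): $c_\vartriangleleft(A)=\{x\mid\forall x'\vartriangleleft x\ \exists x''\vartriangleright x':x''\in A\}$; $\mathfrak{L}(X,\vartriangleleft)$ is the complete lattice of $c_\vartriangleleft$-fixpoints ordered by inclusion (meets are intersections, joins are $c_\vartriangleleft$ of unions); $A\twoheadrightarrow_\vartriangleleft B=\{x\mid\forall y\vartriangleleft x\,(y\in A\Rightarrow\exists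 z\vartriangleright y: z\in A\cap B)\}$; for a relation $\blacktriangleleft$ on $X$, $\neg_\blacktriangleleft A=\{x\mid\forall y\blacktriangleleft x,\ y\notin A\}$. A complete embedding is an injective map preserving all existing meets and joins and commuting with the extra operations. -}

module Defs where

open import Level using (Level)
open import Data.Product using (Σ; ∃; _×_; _,_)
open import Relation.Nullary using (¬_)
open import Relation.Unary using (Pred)
open import Relation.Binary.Lattice.Bundles using (BoundedLattice)

module _ {ℓ : Level} (L : BoundedLattice ℓ ℓ ℓ) where
  open BoundedLattice L

  record IsPreconditional (_⇒_ : Carrier → Carrier → Carrier) : Set ℓ where
    field
      pc1 : ∀ a → (⊤ ⇒ a) ≤ a
      pc2 : ∀ a b → (a ∧ b) ≤ (a ⇒ b)
      pc3 : ∀ a b → (a ⇒ b) ≤ (a ⇒ (a ∧ b))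
      pc4 : ∀ a b c → b ≤ a → (a ⇒ (b ⇒ c)) ≤ (b ⇒ c)
      pc5 : ∀ a b c → b ≤ c → (a ⇒ b) ≤ (a ⇒ c)

  Congruent₂ : (Carrier → Carrier → Carrier) → Set ℓ
  Congruent₂ _⇒_ = ∀ {a a' b b'} → a ≈ a' → b ≈ b' → (a ⇒ b) ≈ (a' ⇒ b')

  Antitone : (Carrier → Carrier) → Set ℓ
  Antitone neg = ∀ {a b} → a ≤ b → neg b ≤ neg a

  IsGlb : Pred Carrier ℓ → Carrier → Set ℓ
  IsGlb S m = (∀ s → S s → m ≤ s) × (∀ u → (∀ s → S s → u ≤ s) → u ≤ m)

  IsLub : Pred Carrier ℓ → Carrier → Set ℓ
  IsLub S j = (∀ s → S s → s ≤ j) × (∀ u → (∀ s → S s → s ≤ u) → j ≤ u)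

  IsComplete : Set _
  IsComplete = ∀ (S : Pred Carrier ℓ) → ∃ λ j → IsLub S j

  module Frame (_⇒_ : Carrier → Carrier → Carrier) (neg : Carrier → Carrier) where

    -- The point (x , x ⇒ y) of P is represented by the pair of parameters x, y.
    record Pt : Set ℓ where
      constructor pt
      field
        px : Carrier
        py : Carrier

    open Pt

    fstP : Pt → Carrier
    fstP p = px p

    sndP : Pt → Carrier
    sndP p = px p ⇒ py p

    _◁_ : Pt → Pt → Set ℓ
    p ◁ q = ¬ (fstP q ≤ sndP p)

    _◀_ : Pt → Pt → Set ℓ
    p' ◀ p = (p' ◁ p) × (∀ a → fstP p ≤ neg a → ¬ (fstP p' ≤ a))

    Subset : Set _
    Subset = Pred Pt ℓ

    _≐_ : Subset → Subset → Set ℓ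
    A ≐ B = (∀ p → A p → B p) × (∀ p → B p → A p)

    cl : Subset → Subset
    cl A x = ∀ x' → x' ◁ x → ∃ λ x'' → (x' ◁ x'') × A x''

    IsFix : Subset → Set ℓ
    IsFix A = A ≐ cl A

    _↠_ : Subset → Subset → Subset
    (A ↠ B) x = ∀ y → y ◁ x → A y → ∃ λ z → (y ◁ z) × A z × B z

    neg◀ : Subset → Subset
    neg◀ A x = ∀ y → y ◀ x → ¬ A y

    -- meets in 𝔏 are intersections, joins are c_◁ of unions
    ⋂ : Pred Carrier ℓ → (Carrier → Subset) → Subset
    ⋂ S e p = ∀ s → S s → e s p

    ⋁ : Pred Carrier ℓ → (Carrier → Subset) → Subset
    ⋁ S e = cl (λ p → ∃ λ s → S s × e s p)

    record IsCompleteEmbedding (e : Carrier → Subset) : Set (Level.suc ℓ) where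
      field
        into      : ∀ a → IsFix (e a)
        wellDef   : ∀ {a b} → a ≈ b → e a ≐ e b
        injective : ∀ {a b} → e a ≐ e b → a ≈ b
        meets     : ∀ (S : Pred Carrier ℓ) m → IsGlb S m → e m ≐ ⋂ S e
        joins     : ∀ (S : Pred Carrier ℓ) j → IsLub S j → e j ≐ ⋁ S e
        impl      : ∀ a b → e (a ⇒ b) ≐ (e a ↠ e b)
        negation  : ∀ a → e (neg a) ≐ neg◀ (e a)

    Surjective : (Carrier → Subset) → Set (Level.suc ℓ)
    Surjective e = ∀ (A : Subset) → IsFix A → ∃ λ a → e a ≐ A

-- Send a to its principal downset ↓a = {(x , x ⇒ y) | x ≤ a}. Since ⊤ ⇒ u ≈ u,
-- the point (⊤ , ⊤ ⇒ u) is ◁-below exactly the points whose first coordinate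
-- is not ≤ u, and this makes c_◁ A the downset of the supremum of the first
-- coordinates of A whenever that supremum exists: hence ↓ is a fixpoint,
-- preserves joins, and, if L is complete, reaches every fixpoint. The points
-- (a , a ⇒ b) and (a , a ⇒ ⊥) witness the equations for ↠ and ¬◀.
module Submission where

open import Defs
open import Level using (Level)
open import Data.Product using (∃; _×_; _,_)
open import Axiom.ExcludedMiddle using (ExcludedMiddle)
open import Axiom.DoubleNegationElimination using (em⇒dne)
open import Relation.Binary.Lattice.Bundles using (BoundedLattice)
open import Relation.Unary using (_⊆′_)

module Downsets {ℓ : Level} (em : ExcludedMiddle ℓ) (L : BoundedLattice ℓ ℓ ℓ)
  (_⇒_ : BoundedLattice.Carrier L → BoundedLattice.Carrier L → BoundedLattice.Carrier L)
  (neg : BoundedLattice.Carrier L → BoundedLattice.Carrier L) where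

  open BoundedLattice L
  open Frame L _⇒_ neg

  ↓ : Carrier → Subset
  ↓ a p = fstP p ≤ a

  IsSupOf : Subset → Carrier → Set ℓ
  IsSupOf A j = (A ⊆′ ↓ j) × (∀ u → A ⊆′ ↓ u → j ≤ u)

  ↓-⊆-cl : ∀ {A j} → (∀ u → A ⊆′ ↓ u → j ≤ u) → ↓ j ⊆′ cl A
  ↓-⊆-cl least x x≤j y y◁x = em⇒dne em λ noWitness →
    y◁x (trans x≤j (least (sndP y) λ q Aq →
      em⇒dne em λ y◁q → noWitness (q , y◁q , Aq)))

  module Preconditional (pc : IsPreconditional L _⇒_) where
    open IsPreconditional pc

    ≤-⊤⇒ : ∀ a → a ≤ (⊤ ⇒ a)
    ≤-⊤⇒ a = trans (∧-greatest (maximum a) refl) (pc2 ⊤ a)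

    a⇒b≤c⇒d : ∀ {a b c d} → c ≤ a → (a ∧ b) ≤ (c ⇒ d) → (a ⇒ b) ≤ (c ⇒ d)
    a⇒b≤c⇒d {a} {b} {c} {d} c≤a a∧b≤c⇒d =
      trans (pc3 a b) (trans (pc5 a (a ∧ b) (c ⇒ d) a∧b≤c⇒d) (pc4 a c d c≤a))

    cl-⊆-↓ : ∀ {A a} → A ⊆′ ↓ a → cl A ⊆′ ↓ a
    cl-⊆-↓ {A} {a} A⊆↓a p clA = em⇒dne em λ p≰a →
      let q , ⊤a◁q , Aq = clA (pt ⊤ a) (λ p≤⊤⇒a → p≰a (trans p≤⊤⇒a (pc1 a)))
      in ⊤a◁q (trans (A⊆↓a q Aq) (≤-⊤⇒ a))

    ↓sup≐cl : ∀ {A j} → IsSupOf A j → ↓ j ≐ cl A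
    ↓sup≐cl (upper , least) = ↓-⊆-cl least , cl-⊆-↓ upper

    ↓-isFix : ∀ a → IsFix (↓ a)
    ↓-isFix a = ↓sup≐cl ((λ _ p≤a → p≤a) , (λ u ↓a⊆↓u → ↓a⊆↓u (pt a a) refl))

    ↓-meets : ∀ S m → IsGlb L S m → ↓ m ≐ ⋂ S ↓
    ↓-meets S m (lower , greatest) =
      (λ p p≤m s Ss → trans p≤m (lower s Ss)) , (λ p p≤S → greatest (fstP p) p≤S)

    ↓-joins : ∀ S j → IsLub L S j → ↓ j ≐ ⋁ S ↓
    ↓-joins S j (upper , least) = ↓sup≐cl
      ( (λ p (s , Ss , p≤s) → trans p≤s (upper s Ss))
      , (λ u ⋃⊆↓u → least u λ s Ss → ⋃⊆↓u (pt s s) (s , Ss , refl)))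

    ↓-⇒ : ∀ a b → ↓ (a ⇒ b) ≐ (↓ a ↠ ↓ b)
    ↓-⇒ a b =
      (λ x x≤a⇒b y y◁x y≤a →
        pt (a ∧ b) (a ∧ b)
        , (λ a∧b≤y → y◁x (trans x≤a⇒b (a⇒b≤c⇒d y≤a a∧b≤y)))
        , x∧y≤x a b , x∧y≤y a b)
      , (λ x ↠x → em⇒dne em λ x≰a⇒b →
          let z , ab◁z , z≤a , z≤b = ↠x (pt a b) x≰a⇒b refl
          in ab◁z (trans (∧-greatest z≤a z≤b) (pc2 a b)))

    ↓-surjective : IsComplete L → Surjective ↓
    ↓-surjective complete A (_ , clA⊆A) with complete (λ s → ∃ λ p → A p × fstP p ≈ s)
    ... | j , upper , least = j , (λ p p≤j → clA⊆A p (↓-⊆-cl least′ p p≤j)) , A⊆↓j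
      where
        A⊆↓j : A ⊆′ ↓ j
        A⊆↓j p Ap = upper (fstP p) (p , Ap , Eq.refl)

        least′ : ∀ u → A ⊆′ ↓ u → j ≤ u
        least′ u A⊆↓u = least u λ s (p , Ap , p≈s) → trans (reflexive (Eq.sym p≈s)) (A⊆↓u p Ap)

    module Negation (antitone : Antitone L neg)
                    (⇒⊥≤neg : ∀ a → (a ⇒ ⊥) ≤ neg a) where

      ↓-neg : ∀ a → ↓ (neg a) ≐ neg◀ (↓ a)
      ↓-neg a =
        (λ x x≤¬a y (_ , y◀x) y≤a → y◀x a x≤¬a y≤a)
        , (λ x ¬◀x → em⇒dne em λ x≰¬a →
            ¬◀x (pt a ⊥)
              ( (λ x≤a⇒⊥ → x≰¬a (trans x≤a⇒⊥ (⇒⊥≤neg a)))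
              , (λ c x≤¬c a≤c → x≰¬a (trans x≤¬c (antitone a≤c))))
              refl)

      ↓-isCompleteEmbedding : IsCompleteEmbedding ↓
      ↓-isCompleteEmbedding = record
        { into      = ↓-isFix
        ; wellDef   = λ a≈b → (λ p p≤a → trans p≤a (reflexive a≈b))
                            , (λ p p≤b → trans p≤b (reflexive (Eq.sym a≈b)))
        ; injective = λ {a} {b} (↓a⊆↓b , ↓b⊆↓a) → antisym (↓a⊆↓b (pt a a) refl) (↓b⊆↓a (pt b b) refl)
        ; meets     = ↓-meets
        ; joins     = ↓-joins
        ; impl      = ↓-⇒
        ; negation  = ↓-neg
        }

theorem6p4 : ∀ {ℓ : Level} → ExcludedMiddle ℓ →
    (L : BoundedLattice ℓ ℓ ℓ) →
    (_⇒_ : BoundedLattice.Carrier L → BoundedLattice.Carrier L → BoundedLattice.Carrier L) →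
    (neg : BoundedLattice.Carrier L → BoundedLattice.Carrier L) →
    IsPreconditional L _⇒_ →
    Congruent₂ L _⇒_ →
    Antitone L neg →
    (∀ a → BoundedLattice._≤_ L (a ⇒ BoundedLattice.⊥ L) (neg a)) →
    ∃ λ (e : BoundedLattice.Carrier L → Frame.Subset L _⇒_ neg) →
      Frame.IsCompleteEmbedding L _⇒_ neg e ×
      (IsComplete L → Frame.Surjective L _⇒_ neg e)
theorem6p4 em L _⇒_ neg pc _ antitone ⇒⊥≤neg =
  ↓ , ↓-isCompleteEmbedding , ↓-surjective
  where
    open Downsets em L _⇒_ neg
    open Preconditional pc
    open Negation antitone ⇒⊥≤neg
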